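{- Let $v,q\ge 2$, $m,s\ge 1$ be integers and $R$ an integer with $0\le R\le ms-2$. Then $$K_{vq}^{RT}(m,s,R)\le OCAN(ms-R,m,s,v)\,K_{q}^{RT}(m,s,R).$$
   Context: For positive integers $m,s$, the RT poset $[m\times s]$ is $\{1,\dots,ms\}$ partitioned into blocks $B_i=\{is+1,\dots,(i+1)s\}$, $i=0,\dots,m-1$, each a chain $is+1\prec\cdots\prec(i+1)s$, with elements of different blocks incomparable. An ideal is a down-closed subset; an anti-ideal is the complement of an ideal; $\langle A\rangle$ is the smallest ideal containing $A$. For an integer $q\ge 2$, the RT distance on $\mathbb{Z}_q^{ms}$ is $d_{RT}(x,y)=|\langle\{i:x_i\ne y_i\}\rangle|$. A code $C\subseteq\mathbb{Z}_q^{ms}$ is an $R$-covering if every $x\in\mathbb{Z}_q^{ms}$ has some $c\in C$ with $d_{RT}(x,c)\le R$; $K_q^{RT}(m,s,R)$ is the minimum size of an $R$-covering. For positive integers $t,m,s,v,N$ with $2\le t\le ms$, an $OCA(N;t,m,s,v)$ is an $N\times ms$ array with entries from an alphabet of size $v$ whose columns are labeled by the elements of the RT poset $[m\times s]$, such that for every anti-ideal $J$ with $|J|=t$, the $N\times t$ subarray formed by the columns labeled by $J$ contains every $t$-tuple over the alphabet as a row at least once. $OCAN(t,m,s,v)$ is the smallest such $N$. -}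

module Defs where

open import Data.Nat using (ℕ; zero; suc; _+_; _*_; _≤_)
open import Data.Bool using (Bool; true; false; not; if_then_else_)
open import Data.Fin using (Fin)
open import Data.Fin.Properties using (_≟_)
open import Data.Product using (Σ; ∃; _×_; _,_)
open import Data.List using (List; map; allFin)
open import Data.Nat.ListAction using (sum)
open import Data.Vec using (Vec)
open import Data.Vec.Membership.Propositional using (_∈_)
open import Relation.Nullary.Decidable using (⌊_⌋; ¬?)
open import Relation.Binary.PropositionalEquality using (_≡_)
import Data.Fin as F

count : ∀ {n} → (Fin n → Bool) → ℕ
count {n} P = sum (map (λ i → if P i then 1 else 0) (allFin n))

-- Elements of the RT poset [m × s]: (i , j) = the (j+1)-th element of block B_i.
-- Order: (i , j) ≼ (i' , j') iff i ≡ i' and j ≤ j'.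
-- Words of Z_q^{ms}: functions Fin m → Fin s → Fin q (only equality of
-- entries matters for the RT distance).
Word : ℕ → ℕ → ℕ → Set
Word q m s = Fin m → Fin s → Fin q

PSubset : ℕ → ℕ → Set
PSubset m s = Fin m → Fin s → Bool

card : ∀ {m s} → PSubset m s → ℕ
card {m} {s} A = sum (map (λ i → count (λ j → A i j)) (allFin m))

generatedIdeal : ∀ {m s} → PSubset m s → PSubset m s
generatedIdeal {m} {s} A i j =
  ⌊ Data.Fin.Properties.any? (λ j' → Data.Bool._≟_ (A i j' Data.Bool.∧ ⌊ j F.≤? j' ⌋) true) ⌋
  where import Data.Fin.Properties
        import Data.Bool

support : ∀ {q m s} → Word q m s → Word q m s → PSubset m s
support x y i j = not ⌊ x i j ≟ y i j ⌋

dRT : ∀ {q m s} → Word q m s → Word q m s → ℕ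
dRT x y = card (generatedIdeal (support x y))

IsCovering : ∀ {q m s k} → ℕ → Vec (Word q m s) k → Set
IsCovering {q} {m} {s} R C = ∀ (x : Word q m s) → ∃ λ c → c ∈ C × dRT x c ≤ R

HasCovering : ℕ → ℕ → ℕ → ℕ → ℕ → Set
HasCovering q m s R k = Σ (Vec (Word q m s) k) (IsCovering R)

IsLeast : (ℕ → Set) → ℕ → Set
IsLeast P K = P K × (∀ k → P k → K ≤ k)

IsKRT : ℕ → ℕ → ℕ → ℕ → ℕ → Set
IsKRT q m s R K = IsLeast (HasCovering q m s R) K

IsIdeal : ∀ {m s} → PSubset m s → Set
IsIdeal {m} {s} I = ∀ (i : Fin m) (j j' : Fin s) → j F.≤ j' → I i j' ≡ true → I i j ≡ true

IsAntiIdeal : ∀ {m s} → PSubset m s → Set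
IsAntiIdeal J = IsIdeal (λ i j → not (J i j))

Array : ℕ → ℕ → ℕ → ℕ → Set
Array N m s v = Fin N → Fin m → Fin s → Fin v

-- orthogonal covering array OCA(N; t, m, s, v): for every anti-ideal J with
-- |J| = t, every t-tuple over the alphabet (a map J → Fin v, given as a map on
-- the whole poset whose values outside J are ignored) occurs as a row of the
-- subarray on columns J.
IsOCA : ∀ {N m s v} → ℕ → Array N m s v → Set
IsOCA {N} {m} {s} {v} t A =
  ∀ (J : PSubset m s) → IsAntiIdeal J → card J ≡ t →
  ∀ (τ : Fin m → Fin s → Fin v) →
  ∃ λ (r : Fin N) → ∀ i j → J i j ≡ true → A r i j ≡ τ i j

HasOCA : ℕ → ℕ → ℕ → ℕ → ℕ → Set
HasOCA t m s v N = Σ (Array N m s v) (IsOCA t)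

IsOCAN : ℕ → ℕ → ℕ → ℕ → ℕ → Set
IsOCAN t m s v N = IsLeast (HasOCA t m s v) N

{-# OPTIONS --safe #-}
-- Identify Z_{vq} with Z_v × Z_q and take as code all words pairing a row of an
-- OCA(ms − R; m, s, v) with a codeword of an R-covering of Z_q^{ms}.  Given
-- x = (x₁ , x₂), cover x₂ by c: the ideal generated by supp(x₂ − c) has at most R
-- elements, so it extends to an ideal I with exactly R elements.  The complement
-- of I is an anti-ideal with ms − R elements, hence some OCA row agrees with x₁
-- there; x and (row , c) then differ only inside the ideal I, so their RT
-- distance is at most |I| = R.
module Submission where

open import Defs
open import Data.Bool using (Bool; true; false; not; _∧_; if_then_else_)
open import Data.Bool.Properties using (not-involutive; not-injective; ∧-conicalˡ; ∧-conicalʳ; T-≡)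
open import Data.Fin using (Fin; zero; suc; toℕ; combine; remQuot)
import Data.Fin as Fin
open import Data.Fin.Properties using (toℕ<n; combine-remQuot)
import Data.Fin.Properties as Fin
import Data.List as List using (map; tabulate; allFin)
open import Data.List.Properties using (map-tabulate)
import Data.Nat.ListAction as List
open import Data.Nat using (ℕ; zero; suc; _+_; _*_; _∸_; _≤_; _<_; _<ᵇ_; z≤n; s≤s; _≤?_; s≤s⁻¹)
open import Data.Nat.Properties
open import Algebra.Properties.CommutativeMonoid.Sum +-0-commutativeMonoid
  using (sum-syntax; ∑-distrib-+; sum-cong-≗)
open import Data.Vec.Functional using (_∷_)
open import Data.Product using (∃; _×_; _,_; proj₁; proj₂; uncurry)
open import Data.Vec using (Vec; allPairs; tabulate; map)
open import Data.Vec.Membership.Propositional.Properties using (∈-map⁺; ∈-allPairs⁺; ∈-tabulate⁺)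
open import Function using (_∘_; id; Equivalence)
open import Relation.Nullary using (Dec; yes; no; contradiction)
open import Relation.Nullary.Decidable using (⌊_⌋; isYes≗does; dec-true)
open import Relation.Binary.PropositionalEquality

∑-mono-≤ : ∀ {n} {f g : Fin n → ℕ} → (∀ i → f i ≤ g i) → ∑[ i < n ] f i ≤ ∑[ i < n ] g i
∑-mono-≤ {zero} f≤g = z≤n
∑-mono-≤ {suc n} f≤g = +-mono-≤ (f≤g zero) (∑-mono-≤ (f≤g ∘ suc))

∑-const : ∀ n c → ∑[ i < n ] c ≡ n * c
∑-const zero c = refl
∑-const (suc n) c = cong (c +_) (∑-const n c)

sum-allFin : ∀ {n} (f : Fin n → ℕ) → List.sum (List.map f (List.allFin n)) ≡ ∑[ i < n ] f i
sum-allFin {zero} f = refl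
sum-allFin {suc n} f = cong (f zero +_) (begin
  List.sum (List.map f (List.tabulate suc))        ≡⟨ cong List.sum (map-tabulate suc f) ⟩
  List.sum (List.tabulate (f ∘ suc))               ≡⟨ cong List.sum (map-tabulate id (f ∘ suc)) ⟨
  List.sum (List.map (f ∘ suc) (List.allFin n))    ≡⟨ sum-allFin (f ∘ suc) ⟩
  ∑[ i < n ] f (suc i)                             ∎)
  where open ≡-Reasoning

∑-fill : ∀ {n} c (f : Fin n → ℕ) {R} → (∀ i → f i ≤ c) → ∑[ i < n ] f i ≤ R → R ≤ n * c →
  ∃ λ (g : Fin n → ℕ) → (∀ i → f i ≤ g i) × (∀ i → g i ≤ c) × ∑[ i < n ] g i ≡ R
∑-fill {zero} c f f≤c z≤n z≤n = f , (λ ()) , (λ ()) , refl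
∑-fill {suc n} c f {R} f≤c ∑f≤R R≤nc with R ≤? c + ∑[ i < n ] f (suc i)
... | yes R≤c+T =
  (R ∸ T) ∷ (f ∘ suc) ,
  (λ { zero → m+n≤o⇒m≤o∸n (f zero) ∑f≤R ; (suc i) → ≤-refl }) ,
  (λ { zero → m≤n+o⇒m∸n≤o R T (subst (R ≤_) (+-comm c T) R≤c+T) ; (suc i) → f≤c (suc i) }) ,
  m∸n+n≡m (m+n≤o⇒n≤o (f zero) ∑f≤R)
  where T = ∑[ i < n ] f (suc i)
... | no R≰c+T with <⇒≤ (≰⇒> R≰c+T)
...   | c+T≤R with ∑-fill c (f ∘ suc) (f≤c ∘ suc)
                   (m+n≤o⇒m≤o∸n _ (subst (_≤ R) (+-comm c _) c+T≤R)) (m≤n+o⇒m∸n≤o R c R≤nc)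
...     | g , f≤g , g≤c , ∑g≡R∸c =
  c ∷ g ,
  (λ { zero → f≤c zero ; (suc i) → f≤g i }) ,
  (λ { zero → ≤-refl ; (suc i) → g≤c i }) ,
  trans (cong (c +_) ∑g≡R∸c) (m+[n∸m]≡n (m+n≤o⇒m≤o c c+T≤R))

indicator : Bool → ℕ
indicator b = if b then 1 else 0

count-∑ : ∀ {n} (P : Fin n → Bool) → count P ≡ ∑[ i < n ] indicator (P i)
count-∑ P = sum-allFin (indicator ∘ P)

count-mono : ∀ {n} {P Q : Fin n → Bool} → (∀ k → P k ≡ true → Q k ≡ true) → count P ≤ count Q
count-mono {P = P} {Q} P⊆Q
  rewrite count-∑ P | count-∑ Q = ∑-mono-≤ (λ k → indicator-mono (P k) (Q k) (P⊆Q k))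
  where
  indicator-mono : ∀ a b → (a ≡ true → b ≡ true) → indicator a ≤ indicator b
  indicator-mono false b _ = z≤n
  indicator-mono true b a⇒b rewrite a⇒b refl = ≤-refl

count-not-+ : ∀ {n} (P : Fin n → Bool) → count (not ∘ P) + count P ≡ n
count-not-+ {n} P = begin
  count (not ∘ P) + count P
    ≡⟨ cong₂ _+_ (count-∑ (not ∘ P)) (count-∑ P) ⟩
  ∑[ i < n ] indicator (not (P i)) + ∑[ i < n ] indicator (P i)
    ≡⟨ ∑-distrib-+ {n} (indicator ∘ not ∘ P) (indicator ∘ P) ⟨
  ∑[ i < n ] (indicator (not (P i)) + indicator (P i))
    ≡⟨ sum-cong-≗ {n} (λ i → indicator-not-+ (P i)) ⟩
  ∑[ i < n ] 1
    ≡⟨ ∑-const n 1 ⟩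
  n * 1
    ≡⟨ *-identityʳ n ⟩
  n ∎
  where
  open ≡-Reasoning
  indicator-not-+ : ∀ b → indicator (not b) + indicator b ≡ 1
  indicator-not-+ false = refl
  indicator-not-+ true = refl

count≤n : ∀ {n} (P : Fin n → Bool) → count P ≤ n
count≤n P = m+n≤o⇒n≤o (count (not ∘ P)) (≤-reflexive (count-not-+ P))

count-<ᵇ : ∀ {n} h → h ≤ n → count {n} (λ j → toℕ j <ᵇ h) ≡ h
count-<ᵇ {n} h h≤n = trans (count-∑ {n} (λ j → toℕ j <ᵇ h)) (∑-<ᵇ h h≤n)
  where
  ∑-<ᵇ : ∀ {n} h → h ≤ n → ∑[ j < n ] indicator (toℕ j <ᵇ h) ≡ h
  ∑-<ᵇ {zero} zero _ = refl
  ∑-<ᵇ {suc n} zero _ = ∑-<ᵇ {n} zero z≤n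
  ∑-<ᵇ {suc n} (suc h) (s≤s h≤n) = cong suc (∑-<ᵇ h h≤n)

_⊆_ : ∀ {m s} → PSubset m s → PSubset m s → Set
A ⊆ B = ∀ i j → A i j ≡ true → B i j ≡ true

⊆⇒false : ∀ {m s} {A B : PSubset m s} → A ⊆ B → ∀ {i j} → B i j ≡ false → A i j ≡ false
⊆⇒false {A = A} A⊆B {i} {j} Bij≡false with A i j in Aij
... | false = refl
... | true = contradiction (trans (sym Bij≡false) (A⊆B i j Aij)) λ ()

_ᶜ : ∀ {m s} → PSubset m s → PSubset m s
(A ᶜ) i j = not (A i j)

card-∑ : ∀ {m s} (A : PSubset m s) → card A ≡ ∑[ i < m ] count (A i)
card-∑ A = sum-allFin (λ i → count (A i))

card-mono : ∀ {m s} {A B : PSubset m s} → A ⊆ B → card A ≤ card B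
card-mono {A = A} {B} A⊆B rewrite card-∑ A | card-∑ B = ∑-mono-≤ (λ i → count-mono (A⊆B i))

card-ᶜ-+ : ∀ {m s} (A : PSubset m s) → card (A ᶜ) + card A ≡ m * s
card-ᶜ-+ {m} {s} A = begin
  card (A ᶜ) + card A                                  ≡⟨ cong₂ _+_ (card-∑ (A ᶜ)) (card-∑ A) ⟩
  ∑[ i < m ] count ((A ᶜ) i) + ∑[ i < m ] count (A i)  ≡⟨ ∑-distrib-+ {m} (count ∘ (A ᶜ)) (count ∘ A) ⟨
  ∑[ i < m ] (count ((A ᶜ) i) + count (A i))           ≡⟨ sum-cong-≗ {m} (count-not-+ ∘ A) ⟩
  ∑[ i < m ] s                                         ≡⟨ ∑-const m s ⟩
  m * s                                                ∎
  where open ≡-Reasoning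

card-ᶜ : ∀ {m s} (A : PSubset m s) → card (A ᶜ) ≡ m * s ∸ card A
card-ᶜ A = trans (sym (m+n∸n≡m (card (A ᶜ)) (card A))) (cong (_∸ card A) (card-ᶜ-+ A))

ᶜ-isAntiIdeal : ∀ {m s} {I : PSubset m s} → IsIdeal I → IsAntiIdeal (I ᶜ)
ᶜ-isAntiIdeal {I = I} I-ideal i j j' j≤j' Iij' =
  trans (not-involutive (I i j)) (I-ideal i j j' j≤j' (trans (sym (not-involutive (I i j'))) Iij'))

⌊⌋-true⁻¹ : ∀ {a} {A : Set a} (a? : Dec A) → ⌊ a? ⌋ ≡ true → A
⌊⌋-true⁻¹ (yes a) _ = a

⌊⌋-true : ∀ {a} {A : Set a} (a? : Dec A) → A → ⌊ a? ⌋ ≡ true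
⌊⌋-true a? a = trans (isYes≗does a?) (dec-true a? a)

generatedIdeal-true⁻¹ : ∀ {m s} (A : PSubset m s) {i j} → generatedIdeal A i j ≡ true →
  ∃ λ j' → j Fin.≤ j' × A i j' ≡ true
generatedIdeal-true⁻¹ A {i} {j} ⟨A⟩ij with ⌊⌋-true⁻¹ (Fin.any? _) ⟨A⟩ij
... | j' , Aij'∧j≤j' = j' , ⌊⌋-true⁻¹ (j Fin.≤? j') (∧-conicalʳ _ _ Aij'∧j≤j') , ∧-conicalˡ _ _ Aij'∧j≤j'

generatedIdeal-true : ∀ {m s} (A : PSubset m s) {i j j'} → j Fin.≤ j' → A i j' ≡ true →
  generatedIdeal A i j ≡ true
generatedIdeal-true A {j = j} {j'} j≤j' Aij' =
  ⌊⌋-true (Fin.any? _) (j' , cong₂ _∧_ Aij' (⌊⌋-true (j Fin.≤? j') j≤j'))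

generatedIdeal-isIdeal : ∀ {m s} (A : PSubset m s) → IsIdeal (generatedIdeal A)
generatedIdeal-isIdeal A i j j' j≤j' ⟨A⟩ij' with generatedIdeal-true⁻¹ A ⟨A⟩ij'
... | k , j'≤k , Aik = generatedIdeal-true A (Fin.≤-trans j≤j' j'≤k) Aik

⊆-generatedIdeal : ∀ {m s} (A : PSubset m s) → A ⊆ generatedIdeal A
⊆-generatedIdeal A i j = generatedIdeal-true A Fin.≤-refl

generatedIdeal-least : ∀ {m s} {A I : PSubset m s} → IsIdeal I → A ⊆ I → generatedIdeal A ⊆ I
generatedIdeal-least {A = A} I-ideal A⊆I i j ⟨A⟩ij with generatedIdeal-true⁻¹ A ⟨A⟩ij
... | j' , j≤j' , Aij' = I-ideal i j j' j≤j' (A⊆I i j' Aij')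

<ᵇ-true : ∀ {m n} → m < n → (m <ᵇ n) ≡ true
<ᵇ-true m<n = Equivalence.to T-≡ (<⇒<ᵇ m<n)

<ᵇ-true⁻¹ : ∀ m n → (m <ᵇ n) ≡ true → m < n
<ᵇ-true⁻¹ m n m<ᵇn = <ᵇ⇒< m n (Equivalence.from T-≡ m<ᵇn)

belowHeights : ∀ {m s} → (Fin m → ℕ) → PSubset m s
belowHeights h i j = toℕ j <ᵇ h i

belowHeights-isIdeal : ∀ {m s} (h : Fin m → ℕ) → IsIdeal (belowHeights {s = s} h)
belowHeights-isIdeal h i j j' j≤j' j'<h =
  <ᵇ-true (≤-<-trans j≤j' (<ᵇ-true⁻¹ (toℕ j') (h i) j'<h))

card-belowHeights : ∀ {m s} {h : Fin m → ℕ} → (∀ i → h i ≤ s) →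
  card (belowHeights {s = s} h) ≡ ∑[ i < m ] h i
card-belowHeights {m} {s} {h} h≤s =
  trans (card-∑ (belowHeights {s = s} h)) (sum-cong-≗ {m} (λ i → count-<ᵇ (h i) (h≤s i)))

toℕ<count : ∀ {m s} {I : PSubset m s} → IsIdeal I → ∀ {i j} → I i j ≡ true → toℕ j < count (I i)
toℕ<count {I = I} I-ideal {i} {j} Iij =
  subst (_≤ count (I i)) (count-<ᵇ (suc (toℕ j)) (toℕ<n j))
    (count-mono λ k k≤j → I-ideal i k j (s≤s⁻¹ (<ᵇ-true⁻¹ (toℕ k) (suc (toℕ j)) k≤j)) Iij)

ideal⊆belowHeights : ∀ {m s} {I : PSubset m s} {h : Fin m → ℕ} → IsIdeal I →
  (∀ i → count (I i) ≤ h i) → I ⊆ belowHeights h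
ideal⊆belowHeights {h = h} I-ideal count≤h i j Iij =
  <ᵇ-true (<-≤-trans (toℕ<count I-ideal Iij) (count≤h i))

ideal-extension : ∀ {m s R} {G : PSubset m s} → IsIdeal G → card G ≤ R → R ≤ m * s →
  ∃ λ (I : PSubset m s) → IsIdeal I × G ⊆ I × card I ≡ R
ideal-extension {s = s} {R} {G} G-ideal |G|≤R R≤ms
  with ∑-fill s (count ∘ G) (count≤n ∘ G) (subst (_≤ R) (card-∑ G) |G|≤R) R≤ms
... | h , count≤h , h≤s , ∑h≡R =
  belowHeights h , belowHeights-isIdeal h , ideal⊆belowHeights G-ideal count≤h ,
  trans (card-belowHeights h≤s) ∑h≡R

≡⇒support-false : ∀ {q m s} {x y : Word q m s} {i j} → x i j ≡ y i j → support x y i j ≡ false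
≡⇒support-false {x = x} {y} {i} {j} xij≡yij = cong not (⌊⌋-true (x i j Fin.≟ y i j) xij≡yij)

support-false⇒≡ : ∀ {q m s} {x y : Word q m s} {i j} → support x y i j ≡ false → x i j ≡ y i j
support-false⇒≡ {x = x} {y} {i} {j} supp≡false = ⌊⌋-true⁻¹ (x i j Fin.≟ y i j) (not-injective supp≡false)

support-⊆ : ∀ {q m s} {x y : Word q m s} {I : PSubset m s} →
  (∀ i j → I i j ≡ false → x i j ≡ y i j) → support x y ⊆ I
support-⊆ {x = x} {y} {I} agree i j supp with I i j in Iij
... | true = refl
... | false = contradiction (trans (sym (≡⇒support-false {x = x} {y} (agree i j Iij))) supp) λ ()

module _ {v q m s : ℕ} where

  high : Word (v * q) m s → Fin m → Fin s → Fin v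
  high x i j = proj₁ (remQuot q (x i j))

  low : Word (v * q) m s → Word q m s
  low x i j = proj₂ (remQuot {v} q (x i j))

  pair : (Fin m → Fin s → Fin v) → Word q m s → Word (v * q) m s
  pair a c i j = combine (a i j) (c i j)

  support-pair : ∀ {x : Word (v * q) m s} {a c} {I : PSubset m s} →
    (∀ i j → I i j ≡ false → a i j ≡ high x i j) → support (low x) c ⊆ I →
    support x (pair a c) ⊆ I
  support-pair {x} {a} {c} a≡high supp⊆I = support-⊆ {x = x} {pair a c} λ i j Iij≡false → begin
    x i j                              ≡⟨ combine-remQuot {v} q (x i j) ⟨
    combine (high x i j) (low x i j)   ≡⟨ cong₂ combine (sym (a≡high i j Iij≡false))
                                            (support-false⇒≡ {x = low x} {c} (⊆⇒false supp⊆I Iij≡false)) ⟩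
    combine (a i j) (c i j)            ∎
    where open ≡-Reasoning

productCode : ∀ {v q m s N K} → Array N m s v → Vec (Word q m s) K → Vec (Word (v * q) m s) (N * K)
productCode {v} {q} A C = map (uncurry (pair {v} {q})) (allPairs (tabulate A) C)

productCode-isCovering : ∀ {v q m s N K R} {A : Array N m s v} {C : Vec (Word q m s) K} →
  R ≤ m * s → IsOCA (m * s ∸ R) A → IsCovering R C → IsCovering R (productCode A C)
productCode-isCovering {v} {q} {m} {s} {R = R} {A} {C} R≤ms A-oca C-covering x
  with C-covering (low {v} x)
... | c , c∈C , d[low,c]≤R
  with ideal-extension (generatedIdeal-isIdeal (support (low {v} x) c)) d[low,c]≤R R≤ms
... | I , I-ideal , ⟨supp⟩⊆I , |I|≡R
  with A-oca (I ᶜ) (ᶜ-isAntiIdeal I-ideal) (trans (card-ᶜ I) (cong (m * s ∸_) |I|≡R)) (high {v} {q} x)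
... | r , Ar≡high =
  pair (A r) c , ∈-map⁺ (uncurry (pair {v} {q})) (∈-allPairs⁺ (∈-tabulate⁺ A r) c∈C) , (begin
    dRT x (pair (A r) c)  ≤⟨ card-mono (generatedIdeal-least {A = support x (pair (A r) c)} I-ideal supp⊆I) ⟩
    card I                ≡⟨ |I|≡R ⟩
    R                     ∎)
  where
  open ≤-Reasoning
  supp⊆I : support x (pair (A r) c) ⊆ I
  supp⊆I = support-pair (λ i j Iij≡false → Ar≡high i j (cong not Iij≡false))
                        (λ i j → ⟨supp⟩⊆I i j ∘ ⊆-generatedIdeal (support (low {v} x) c) i j)

theorem3 : (v q m s R K Kvq N : ℕ) →
    2 ≤ v → 2 ≤ q → 1 ≤ m → 1 ≤ s → R + 2 ≤ m * s →
    IsKRT (v * q) m s R Kvq →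
    IsOCAN (m * s ∸ R) m s v N →
    IsKRT q m s R K →
    Kvq ≤ N * K
theorem3 v q m s R K Kvq N _ _ _ _ R+2≤ms (_ , Kvq-least) ((A , A-oca) , _) ((C , C-covering) , _) =
  Kvq-least (N * K) (productCode A C , productCode-isCovering (m+n≤o⇒m≤o R R+2≤ms) A-oca C-covering)
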